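{- Let $k\ge4$ be even and let $r,N$ be positive integers. Suppose there exists an $r$-coloring of $\mathbb{Z}/N\mathbb{Z}$ with no symmetrically colored $k$-AP. Then for every positive integer $\ell$ there exists an $r^\ell$-coloring of $\mathbb{Z}/N^\ell\mathbb{Z}$ with no symmetrically colored $k$-AP.
   Context: In $\mathbb{Z}/M\mathbb{Z}$, for even $k$, a $k$-AP $n,n+d,\dots,n+(k-1)d$ with $d\ne0$ is symmetrically colored if $n+(i-1)d$ and $n+(k-i)d$ have the same color for each $i=1,\dots,k/2$. -}

module Defs where

open import Data.Nat using (ℕ; zero; suc; _+_; _*_; _∸_; _%_; NonZero)
open import Data.Nat.DivMod using (m%n<n)
open import Data.Fin using (Fin; toℕ; fromℕ<)
open import Relation.Binary.PropositionalEquality using (_≡_)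
open import Relation.Nullary using (¬_)
open import Data.Product using (∃; _×_)

-- ℤ/Mℤ is modelled as Fin M (residues 0,…,M-1), for M > 0.

apTerm : (M : ℕ) .{{_ : NonZero M}} → Fin M → Fin M → ℕ → Fin M
apTerm M n d j = fromℕ< (m%n<n (toℕ n + j * toℕ d) M)

Coloring : ℕ → ℕ → Set
Coloring M r = Fin M → Fin r

-- For even k = 2m, the k-AP n, n+d, …, n+(k-1)d (d ≠ 0) is symmetrically
-- colored if for each i = 1,…,m, terms n+(i-1)d and n+(k-i)d share a color.
-- With 0-based i' = i-1 ∈ {0,…,m-1}: terms i' and (2m-1-i').
SymColoredAP : (M : ℕ) .{{_ : NonZero M}} {r : ℕ} → Coloring M r →
               (m : ℕ) → Fin M → Fin M → Set
SymColoredAP M c m n d =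
  ¬ (toℕ d ≡ 0) ×
  ((i : Fin m) → c (apTerm M n d (toℕ i)) ≡ c (apTerm M n d ((m + m ∸ 1) ∸ toℕ i)))

NoSymAP : (M : ℕ) .{{_ : NonZero M}} {r : ℕ} → Coloring M r → ℕ → Set
NoSymAP M c m = ∀ n d → ¬ SymColoredAP M c m n d

module Submission where

open import Defs
open import Data.Nat using (ℕ; zero; suc; _+_; _*_; _∸_; _^_; _≤_; _<_; _%_; _/_; NonZero; _≟_)
open import Data.Nat.Properties using (m^n≢0; m*n≢0; *-comm)
open import Data.Nat.DivMod
open import Data.Nat.Divisibility using (_∣_; m%n≡0⇒n∣m; m∣m*n; ∣n⇒∣m*n)
open import Data.Fin using (Fin; toℕ; combine)
import Data.Fin as Fin
open import Data.Fin.Properties using (toℕ-fromℕ<; fromℕ<-cong; toℕ<n; combine-injectiveˡ; combine-injectiveʳ)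
open import Data.Product using (∃; _,_)
open import Relation.Binary.PropositionalEquality
open import Relation.Nullary using (yes; no; ¬_)

-- Colour x ∈ ℤ/ABℤ by the pair of colours of its two mixed-radix digits x mod A and
-- ⌊x/A⌋ mod B. A symmetrically coloured k-AP with difference d then projects to one in
-- ℤ/Aℤ (if A ∤ d) or, through the high digit, to one in ℤ/Bℤ with difference d/A
-- (if A ∣ d, where 0 < d < AB forces d/A ≢ 0 mod B). Iterating this product with
-- the given colouring of ℤ/Nℤ colours ℤ/N^ℓℤ with r^ℓ colours.

module _ (A : ℕ) .{{_ : NonZero A}} where

  toℕ-mod : ∀ a → toℕ (a mod A) ≡ a % A
  toℕ-mod a = toℕ-fromℕ< (m%n<n a A)

  %⇒mod : ∀ {a b} → a % A ≡ b % A → a mod A ≡ b mod A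
  %⇒mod eq = fromℕ<-cong _ _ eq _ _

  m*n%d≡m*[n%d]%d : ∀ m n → m * n % A ≡ m * (n % A) % A
  m*n%d≡m*[n%d]%d m n = begin
    m * n % A                  ≡⟨ %-distribˡ-* m n A ⟩
    (m % A * (n % A)) % A      ≡⟨ cong (λ t → (m % A * t) % A) (m%n%n≡m%n n A) ⟨
    (m % A * (n % A % A)) % A  ≡⟨ %-distribˡ-* m (n % A) A ⟨
    m * (n % A) % A            ∎
    where open ≡-Reasoning

  %-affine : ∀ a b j → (a + j * b) % A ≡ (a % A + j * (b % A)) % A
  %-affine a b j = begin
    (a + j * b) % A                      ≡⟨ %-distribˡ-+ a (j * b) A ⟩
    (a % A + j * b % A) % A              ≡⟨ cong₂ (λ x y → (x + y) % A) (sym (m%n%n≡m%n a A)) (m*n%d≡m*[n%d]%d j b) ⟩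
    (a % A % A + j * (b % A) % A) % A    ≡⟨ %-distribˡ-+ (a % A) (j * (b % A)) A ⟨
    (a % A + j * (b % A)) % A            ∎
    where open ≡-Reasoning

  mod-affine : ∀ a b j → (a + j * b) mod A ≡ apTerm A (a mod A) (b mod A) j
  mod-affine a b j = %⇒mod (begin
    (a + j * b) % A                                  ≡⟨ %-affine a b j ⟩
    (a % A + j * (b % A)) % A                        ≡⟨ cong₂ (λ x y → (x + j * y) % A) (toℕ-mod a) (toℕ-mod b) ⟨
    (toℕ (a mod A) + j * toℕ (b mod A)) % A          ∎)
    where open ≡-Reasoning

  /-affine : ∀ a {b} j → A ∣ b → (a + j * b) / A ≡ a / A + j * (b / A)
  /-affine a {b} j A∣b = begin
    (a + j * b) / A        ≡⟨ +-distrib-/-∣ʳ a (∣n⇒∣m*n j A∣b) ⟩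
    a / A + j * b / A      ≡⟨ cong (a / A +_) (*-/-assoc j A∣b) ⟩
    a / A + j * (b / A)    ∎
    where open ≡-Reasoning

symColoredAP-map : ∀ {M M′ r r′} .{{_ : NonZero M}} .{{_ : NonZero M′}}
  (c : Coloring M r) (c′ : Coloring M′ r′) {m n d n′ d′} (f : Fin M → Fin M′) →
  (∀ {x y} → c x ≡ c y → c′ (f x) ≡ c′ (f y)) →
  (∀ j → f (apTerm M n d j) ≡ apTerm M′ n′ d′ j) →
  ¬ toℕ d′ ≡ 0 → SymColoredAP M c m n d → SymColoredAP M′ c′ m n′ d′
symColoredAP-map c c′ {m} f f-resp f-ap d′≢0 (_ , symmetric) =
  d′≢0 , λ i →
    subst₂ (λ u v → c′ u ≡ c′ v) (f-ap (toℕ i)) (f-ap (m + m ∸ 1 ∸ toℕ i)) (f-resp (symmetric i))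

noSymAP-trivial : ∀ {r} (c : Coloring 1 r) m → NoSymAP 1 c m
noSymAP-trivial c m n Fin.zero (d≢0 , _) = d≢0 refl

module _ {A B : ℕ} .{{_ : NonZero A}} .{{_ : NonZero B}} where

  instance
    A*B≢0 : NonZero (A * B)
    A*B≢0 = m*n≢0 A B

    B*A≢0 : NonZero (B * A)
    B*A≢0 = m*n≢0 B A

  lowDigit : Fin (A * B) → Fin A
  lowDigit x = toℕ x mod A

  highDigit : Fin (A * B) → Fin B
  highDigit x = (toℕ x / A) mod B

  productColoring : ∀ {r s} → Coloring A r → Coloring B s → Coloring (A * B) (r * s)
  productColoring c₁ c₂ x = combine (c₁ (lowDigit x)) (c₂ (highDigit x))

  module _ {r s} (c₁ : Coloring A r) (c₂ : Coloring B s) {x y : Fin (A * B)}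
           (same : productColoring c₁ c₂ x ≡ productColoring c₁ c₂ y) where

    productColoring-injectiveˡ : c₁ (lowDigit x) ≡ c₁ (lowDigit y)
    productColoring-injectiveˡ =
      combine-injectiveˡ (c₁ (lowDigit x)) (c₂ (highDigit x)) (c₁ (lowDigit y)) (c₂ (highDigit y)) same

    productColoring-injectiveʳ : c₂ (highDigit x) ≡ c₂ (highDigit y)
    productColoring-injectiveʳ =
      combine-injectiveʳ (c₁ (lowDigit x)) (c₂ (highDigit x)) (c₁ (lowDigit y)) (c₂ (highDigit y)) same

  lowDigit-apTerm : ∀ n d j → lowDigit (apTerm (A * B) n d j) ≡ apTerm A (lowDigit n) (lowDigit d) j
  lowDigit-apTerm n d j = begin
    toℕ (s mod (A * B)) mod A             ≡⟨ %⇒mod A low%A ⟩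
    s mod A                               ≡⟨ mod-affine A (toℕ n) (toℕ d) j ⟩
    apTerm A (lowDigit n) (lowDigit d) j  ∎
    where
      open ≡-Reasoning
      s = toℕ n + j * toℕ d
      low%A : toℕ (s mod (A * B)) % A ≡ s % A
      low%A = trans (cong (_% A) (toℕ-mod (A * B) s)) (m∣n⇒o%n%m≡o%m A (A * B) s (m∣m*n B))

  highDigit-apTerm : ∀ n d → A ∣ toℕ d → ∀ j →
    highDigit (apTerm (A * B) n d j) ≡ apTerm B (highDigit n) (highDigit d) j
  highDigit-apTerm n d A∣d j = begin
    (toℕ (s mod (A * B)) / A) mod B           ≡⟨ %⇒mod B high%B ⟩
    (s / A) mod B                              ≡⟨ cong (_mod B) (/-affine A (toℕ n) j A∣d) ⟩
    (toℕ n / A + j * (toℕ d / A)) mod B        ≡⟨ mod-affine B (toℕ n / A) (toℕ d / A) j ⟩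
    apTerm B (highDigit n) (highDigit d) j     ∎
    where
      open ≡-Reasoning
      s = toℕ n + j * toℕ d
      high%B : toℕ (s mod (A * B)) / A % B ≡ s / A % B
      high%B = begin
        toℕ (s mod (A * B)) / A % B  ≡⟨ cong (λ t → t / A % B) (toℕ-mod (A * B) s) ⟩
        s % (A * B) / A % B          ≡⟨ cong (λ t → t / A % B) (%-congʳ (*-comm A B)) ⟩
        s % (B * A) / A % B          ≡⟨ cong (_% B) (m%[n*o]/o≡m/o%n s B A) ⟩
        s / A % B % B                ≡⟨ m%n%n≡m%n (s / A) B ⟩
        s / A % B                    ∎

  highDigit≡0⇒≡0 : ∀ d → toℕ d % A ≡ 0 → toℕ (highDigit d) ≡ 0 → toℕ d ≡ 0
  highDigit≡0⇒≡0 d d%A≡0 high≡0 = trans (sym (m<n⇒m%n≡m (m/n≡0⇒m<n d/A≡0))) d%A≡0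
    where
      d/A<B : toℕ d / A < B
      d/A<B = m<n*o⇒m/o<n (subst (toℕ d <_) (*-comm A B) (toℕ<n d))
      d/A≡0 : toℕ d / A ≡ 0
      d/A≡0 = trans (sym (m<n⇒m%n≡m d/A<B)) (trans (sym (toℕ-mod B (toℕ d / A))) high≡0)

  noSymAP-product : ∀ {r s m} (c₁ : Coloring A r) (c₂ : Coloring B s) →
    NoSymAP A c₁ m → NoSymAP B c₂ m → NoSymAP (A * B) (productColoring c₁ c₂) m
  noSymAP-product c₁ c₂ noSym₁ noSym₂ n d symAP@(d≢0 , _) with toℕ d % A ≟ 0
  ... | no d%A≢0 = noSym₁ (lowDigit n) (lowDigit d)
    (symColoredAP-map (productColoring c₁ c₂) c₁ lowDigit (productColoring-injectiveˡ c₁ c₂)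
      (lowDigit-apTerm n d)
      (λ low≡0 → d%A≢0 (trans (sym (toℕ-mod A (toℕ d))) low≡0)) symAP)
  ... | yes d%A≡0 = noSym₂ (highDigit n) (highDigit d)
    (symColoredAP-map (productColoring c₁ c₂) c₂ highDigit (productColoring-injectiveʳ c₁ c₂)
      (highDigit-apTerm n d (m%n≡0⇒n∣m (toℕ d) A d%A≡0))
      (λ high≡0 → d≢0 (highDigit≡0⇒≡0 d d%A≡0 high≡0)) symAP)

lemma5p1 : (m r N : ℕ) → 2 ≤ m → .{{_ : NonZero r}} → .{{_ : NonZero N}} →
           (∃ λ (c : Coloring N r) → NoSymAP N c m) →
           (ℓ : ℕ) → .{{_ : NonZero ℓ}} →
           ∃ λ (c : Coloring (N ^ ℓ) (r ^ ℓ)) → NoSymAP (N ^ ℓ) {{m^n≢0 N ℓ}} c m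
lemma5p1 m r N _ (c , noSym) ℓ = power ℓ
  where
    power : ∀ ℓ → ∃ λ (c : Coloring (N ^ ℓ) (r ^ ℓ)) → NoSymAP (N ^ ℓ) {{m^n≢0 N ℓ}} c m
    power zero = (λ _ → Fin.zero) , noSymAP-trivial _ m
    power (suc ℓ) with power ℓ
    ... | c′ , noSym′ = productColoring {{_}} {{m^n≢0 N ℓ}} c c′
                      , noSymAP-product {{_}} {{m^n≢0 N ℓ}} c c′ noSym noSym′
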